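{- Let $\mathcal{C}\subseteq\mathcal{T}$ be a subcategory and $\sim$ a congruence relation on $\mathcal{C}$, and assume Axiom 1 ($\mathcal{C}$ contains every morphism of $\mathcal{T}$ that is an injective induced graph map, i.e. $\overline{\mathcal{T}}\subseteq\mathcal{C}$), Axiom 2 (whenever $\phi\sim\phi'$, also $\phi\simeq\phi'$) and Axiom 3 (for every AN $G$, every triad of $G$ and every ordered triple $(i,j,k)$ of its distinct actors, there is at most one wedge at $(i,j,k)$). Then every wedge and every alcove, in any affiliation network, is (represented by) an injective induced graph map.
   Context: An affiliation network (AN) is a finite simple undirected bipartite graph whose nodes are actors and events, each edge joining an actor to an event. A graph map sends nodes to nodes and edges to edges; it is injective if injective on nodes and induced if its image is an induced subgraph of the target. For a set $S$ of actors of $G$, the subgraph scheduled by $S$ is induced by $S$ together with all events attended by at least two actors of $S$; a triad of $G$ is the subgraph scheduled by three actors. Two nodes of a graph are structurally equivalent if exchanging them and fixing all other nodes is an automorphism. $\mathcal{T}$: objects are triads (ANs with three actors, each event attended by at least two), morphisms $H\to K$ are graph maps sending actors of $H$ to distinct actors of $K$ and events to events; $\overline{\mathcal{T}}$ is its subcategory of injective induced morphisms. A congruence relation is a family of equivalence relations on hom-sets compatible with composition; $\phi\simeq\phi'$ iff $\phi,\phi'$ agree on actors and send each event to structurally equivalent events of the target. Fixed: $W$ = path $v_0v_1v_2v_3v_4$ (actors $v_0,v_2,v_4$; events $v_1,v_3$), $X$ = 6-cycle $v_0v_1\cdots v_5v_0$ (actors $v_0,v_2,v_4$; events $v_1,v_3,v_5$),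 $\iota:W\to X$, $\iota(v_i)=v_i$. For an AN $G$, $\mathsf{Hom}_{\mathcal{C}/\sim}(H,G)$ is the set of $\sim$-classes of morphisms in $\mathcal{C}$ from $H$ into triads of $G$. Wedges are elements of $\mathsf{Hom}_{\mathcal{C}/\sim}(W,G)$; alcoves are elements of $\mathsf{Hom}_{\mathcal{C}/\sim}(X,G)$. A wedge is at the ordered triple $(i,j,k)$ if it sends $v_0,v_2,v_4$ to $i,j,k$. -}

module Defs where

open import Data.Nat using (ℕ)
open import Data.Fin using (Fin; zero; suc)
open import Data.Bool using (Bool; true; false)
open import Data.Product using (Σ; _×_; _,_)
open import Data.Sum using (_⊎_)
open import Relation.Binary.PropositionalEquality using (_≡_; _≢_; refl; cong)
open import Function.Definitions using (Injective)

Finite : Set → Set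
Finite A = Σ ℕ λ n → Σ (A → Fin n) λ f → Injective _≡_ _≡_ f

-- Affiliation networks: finite simple undirected bipartite graphs with
-- actors on one side and events on the other; an edge joins an actor to
-- an event and is recorded by the Boolean relation 'attends'.

record AN : Set₁ where
  field
    Actor : Set
    Event : Set
    attends : Actor → Event → Bool
    actorsFinite : Finite Actor
    eventsFinite : Finite Event
open AN public

record Mor (H K : AN) : Set where
  field
    onActor : Actor H → Actor K
    onEvent : Event H → Event K
    preserves : ∀ a e → attends H a e ≡ true →
                 attends K (onActor a) (onEvent e) ≡ true
    actorsDistinct : Injective _≡_ _≡_ onActor
open Mor public

idM : (H : AN) → Mor H H
idM H = record
  { onActor = λ a → a ; onEvent = λ e → e
  ; preserves = λ a e p → p ; actorsDistinct = λ p → p }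

infixr 9 _∘M_
_∘M_ : {H K L : AN} → Mor K L → Mor H K → Mor H L
g ∘M f = record
  { onActor = λ a → onActor g (onActor f a)
  ; onEvent = λ e → onEvent g (onEvent f e)
  ; preserves = λ a e p → preserves g _ _ (preserves f a e p)
  ; actorsDistinct = λ p → actorsDistinct f (actorsDistinct g p) }

_≐_ : {H K : AN} → Mor H K → Mor H K → Set
_≐_ {H} f g = (∀ a → onActor f a ≡ onActor g a) × (∀ e → onEvent f e ≡ onEvent g e)

-- injective on nodes (actors and events are disjoint kinds of nodes)
InjectiveMap : {H K : AN} → Mor H K → Set
InjectiveMap f = Injective _≡_ _≡_ (onActor f) × Injective _≡_ _≡_ (onEvent f)

Induced : {H K : AN} → Mor H K → Set
Induced {H} {K} f = ∀ a e → attends K (onActor f a) (onEvent f e) ≡ true →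
  Σ (Actor H) λ a' → Σ (Event H) λ e' →
    onActor f a' ≡ onActor f a × onEvent f e' ≡ onEvent f e × attends H a' e' ≡ true

IsTriad : AN → Set
IsTriad H =
  (Σ (Actor H) λ a → Σ (Actor H) λ b → Σ (Actor H) λ c →
     a ≢ b × a ≢ c × b ≢ c × (∀ x → x ≡ a ⊎ x ≡ b ⊎ x ≡ c))
  × (∀ e → Σ (Actor H) λ a → Σ (Actor H) λ b →
       a ≢ b × attends H a e ≡ true × attends H b e ≡ true)

-- Structural equivalence of two events of K: swapping them (fixing all
-- other nodes) is an automorphism, i.e. they have the same attendees.

StructEquivEvent : (K : AN) → Event K → Event K → Set
StructEquivEvent K e e' = ∀ a → attends K a e ≡ attends K a e'

_≃_ : {H K : AN} → Mor H K → Mor H K → Set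
_≃_ {H} {K} f g = (∀ a → onActor f a ≡ onActor g a) ×
                  (∀ e → StructEquivEvent K (onEvent f e) (onEvent g e))

-- The subgraph of G scheduled by three actors i, j, k (a triad of G):
-- actors i, j, k and all events attended by at least two of them,
-- with the induced attendance relation.

record SchedActor (G : AN) (i j k : Actor G) : Set where
  constructor sa
  field
    actor : Actor G
    .member : actor ≡ i ⊎ actor ≡ j ⊎ actor ≡ k
open SchedActor public

InS : (G : AN) (i j k : Actor G) → Actor G → Set
InS G i j k a = a ≡ i ⊎ a ≡ j ⊎ a ≡ k

record SchedEvent (G : AN) (i j k : Actor G) : Set where
  constructor se
  field
    event : Event G
    .twoAttend : Σ (Actor G) λ a → Σ (Actor G) λ b →
      a ≢ b × InS G i j k a × InS G i j k b ×
      attends G a event ≡ true × attends G b event ≡ true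
open SchedEvent public

private
  actor-inj : {G : AN} {i j k : Actor G} {x y : SchedActor G i j k} →
              actor x ≡ actor y → x ≡ y
  actor-inj {x = sa a _} {y = sa .a _} refl = refl

  event-inj : {G : AN} {i j k : Actor G} {x y : SchedEvent G i j k} →
              event x ≡ event y → x ≡ y
  event-inj {x = se e _} {y = se .e _} refl = refl

  finSub : {A B : Set} (v : B → A) → (∀ {x y} → v x ≡ v y → x ≡ y) →
           Finite A → Finite B
  finSub v vinj (n , f , finj) = n , (λ b → f (v b)) , λ p → vinj (finj p)

Triad : (G : AN) (i j k : Actor G) → AN
Triad G i j k = record
  { Actor = SchedActor G i j k
  ; Event = SchedEvent G i j k
  ; attends = λ a e → attends G (actor a) (event e)
  ; actorsFinite = finSub actor actor-inj (actorsFinite G)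
  ; eventsFinite = finSub event event-inj (eventsFinite G) }

-- The fixed triads W (path v0 v1 v2 v3 v4) and X (6-cycle v0 ... v5 v0).
-- Actors v0, v2, v4 are zero, suc zero, suc (suc zero);
-- events v1, v3 (, v5) are zero, suc zero (, suc (suc zero)).

private
  finId : (n : ℕ) → Finite (Fin n)
  finId n = n , (λ x → x) , (λ p → p)

attW : Fin 3 → Fin 2 → Bool
attW zero          zero       = true
attW (suc zero)    zero       = true
attW (suc zero)    (suc zero) = true
attW (suc (suc zero)) (suc zero) = true
attW _ _ = false

W : AN
W = record { Actor = Fin 3 ; Event = Fin 2 ; attends = attW
           ; actorsFinite = finId 3 ; eventsFinite = finId 2 }

attX : Fin 3 → Fin 3 → Bool
attX zero             zero             = true
attX (suc zero)       zero             = true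
attX (suc zero)       (suc zero)       = true
attX (suc (suc zero)) (suc zero)       = true
attX (suc (suc zero)) (suc (suc zero)) = true
attX zero             (suc (suc zero)) = true
attX _ _ = false

X : AN
X = record { Actor = Fin 3 ; Event = Fin 3 ; attends = attX
           ; actorsFinite = finId 3 ; eventsFinite = finId 3 }

WedgeAt : {K : AN} → Mor W K → Actor K → Actor K → Actor K → Set
WedgeAt φ x y z = onActor φ zero ≡ x × onActor φ (suc zero) ≡ y × onActor φ (suc (suc zero)) ≡ z

MorPred : Set₁
MorPred = ∀ {H K : AN} → Mor H K → Set

MorRel : Set₁
MorRel = ∀ {H K : AN} → Mor H K → Mor H K → Set

-- 𝒞 is a subcategory of 𝒯 (closed under composition, only morphisms
-- between triads, membership invariant under equality of graph maps).
-- (Identities of all triads lie in 𝒞 by Axiom 1.)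
record IsSubcategory (C : MorPred) : Set₁ where
  field
    dom-triad : ∀ {H K} {f : Mor H K} → C f → IsTriad H
    cod-triad : ∀ {H K} {f : Mor H K} → C f → IsTriad K
    comp : ∀ {H K L} {f : Mor H K} {g : Mor K L} → C f → C g → C (g ∘M f)
    resp : ∀ {H K} {f g : Mor H K} → f ≐ g → C f → C g

-- ∼ is a congruence relation on 𝒞 (only its values on 𝒞-morphisms matter)
record IsCongruence (C : MorPred) (_∼_ : MorRel) : Set₁ where
  field
    refl∼  : ∀ {H K} {f : Mor H K} → C f → f ∼ f
    sym∼   : ∀ {H K} {f g : Mor H K} → C f → C g → f ∼ g → g ∼ f
    trans∼ : ∀ {H K} {f g h : Mor H K} → C f → C g → C h →
             f ∼ g → g ∼ h → f ∼ h
    -- equal graph maps are the same morphism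
    ≐⇒∼    : ∀ {H K} {f g : Mor H K} → C f → C g → f ≐ g → f ∼ g
    compat : ∀ {H K L} {f f' : Mor H K} {g g' : Mor K L} →
             C f → C f' → C g → C g' → f ∼ f' → g ∼ g' →
             (g ∘M f) ∼ (g' ∘M f')

Axiom1 : MorPred → Set₁
Axiom1 C = ∀ {H K} (f : Mor H K) → IsTriad H → IsTriad K →
           InjectiveMap f → Induced f → C f

Axiom2 : MorPred → MorRel → Set₁
Axiom2 C _∼_ = ∀ {H K} {f g : Mor H K} → C f → C g → f ∼ g → f ≃ g

Axiom3 : MorPred → MorRel → Set₁
Axiom3 C _∼_ = ∀ (G : AN) (i j k : Actor G) → i ≢ j → i ≢ k → j ≢ k →
  ∀ (x y z : SchedActor G i j k) → x ≢ y → x ≢ z → y ≢ z →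
  ∀ (φ ψ : Mor W (Triad G i j k)) → C φ → C ψ →
  WedgeAt φ x y z → WedgeAt ψ x y z → φ ∼ ψ

EveryClassInjInduced : MorPred → MorRel → AN → Set₁
EveryClassInjInduced C _∼_ H = ∀ (G : AN) (i j k : Actor G) →
  i ≢ j → i ≢ k → j ≢ k →
  ∀ (φ : Mor H (Triad G i j k)) → C φ →
  Σ (Mor H (Triad G i j k)) λ φ' →
    C φ' × φ ∼ φ' × InjectiveMap φ' × Induced φ'

module Submission where

-- Given a wedge φ at (x, y, z) in a triad of G, adjoin to G a fresh copy of each event of W,
-- attended exactly by the images of its attendees.  The copies form a second wedge at
-- (x, y, z) which is injective and induced, hence lies in 𝒞 (Axiom 1); by Axioms 3 and 2
-- every event of φ has the same attendees as its copy.  So φ is full (it reflects attendance),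
-- and a full map out of W or X, whose events have pairwise distinct attendee sets, is
-- injective and induced.  An alcove is full because every actor–event pair of X lies in the
-- image of ι or of ι followed by a rotation of X, and both composites are wedges.

open import Defs
open import Data.Bool using (Bool; true; false)
import Data.Bool.Properties as Bool
open import Data.Fin using (Fin; zero; suc; inject₁)
open import Data.Fin.Properties using (_≟_; all?; any?; +↔⊎; inj⇒≟)
open import Data.Nat using (_+_)
open import Data.Product using (Σ; _×_; _,_; proj₁; proj₂)
open import Data.Sum using (_⊎_; inj₁; inj₂; [_,_]′)
import Data.Sum as Sum
open import Data.Sum.Properties using (inj₁-injective)
open import Data.Sum.Function.Propositional using (_⊎-↣_)
open import Function using (_∘_; Injection; _↣_; mk↣)
open import Function.Construct.Composition using (_↣-∘_)
open import Function.Definitions using (Injective)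
open import Function.Properties.Inverse using (↔⇒↣; ↔-sym)
open import Relation.Binary.Definitions using (DecidableEquality)
open import Relation.Binary.PropositionalEquality
  using (_≡_; _≢_; refl; sym; trans; cong; subst; module ≡-Reasoning)
open import Relation.Nullary using (Dec; does)
open import Relation.Nullary.Decidable using (dec-true; dec-false; from-yes; _×-dec_; _→-dec_)

finite-⊎ : {A B : Set} → Finite A → Finite B → Finite (A ⊎ B)
finite-⊎ {A} {B} (m , f , f-inj) (n , g , g-inj) = m + n , Injection.to h , Injection.injective h
  where
  h : (A ⊎ B) ↣ Fin (m + n)
  h = ↔⇒↣ (↔-sym +↔⊎) ↣-∘ (mk↣ f-inj ⊎-↣ mk↣ g-inj)

finite⇒≟ : {A : Set} → Finite A → DecidableEquality A
finite⇒≟ (_ , _ , f-inj) = inj⇒≟ (mk↣ f-inj)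

Full : {H K : AN} → Mor H K → Set
Full {H} {K} f = ∀ a e → attends K (onActor f a) (onEvent f e) ≡ attends H a e

EventsSeparated : AN → Set
EventsSeparated H = ∀ e e' → StructEquivEvent H e e' → e ≡ e'

fullMor : {H K : AN} (fa : Actor H → Actor K) (fe : Event H → Event K) →
          Injective _≡_ _≡_ fa → (∀ a e → attends K (fa a) (fe e) ≡ attends H a e) →
          Mor H K
fullMor fa fe fa-inj full = record
  { onActor = fa ; onEvent = fe
  ; preserves = λ a e → trans (full a e) ; actorsDistinct = fa-inj }

full⇒induced : {H K : AN} (f : Mor H K) → Full f → Induced f
full⇒induced f full a e p = a , e , refl , refl , trans (sym (full a e)) p

full⇒onEvent-injective : {H K : AN} (f : Mor H K) → EventsSeparated H → Full f →
                         Injective _≡_ _≡_ (onEvent f)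
full⇒onEvent-injective {H} {K} f separated full {e} {e'} fe≡fe' = separated e e' λ a →
  begin
    attends H a e                         ≡⟨ sym (full a e) ⟩
    attends K (onActor f a) (onEvent f e)  ≡⟨ cong (attends K (onActor f a)) fe≡fe' ⟩
    attends K (onActor f a) (onEvent f e') ≡⟨ full a e' ⟩
    attends H a e'                        ∎
  where open ≡-Reasoning

full-on-image : {H K L : AN} (φ : Mor H K) (r : Mor L H) → Full r → Full (φ ∘M r) →
  ∀ a e → attends K (onActor φ (onActor r a)) (onEvent φ (onEvent r e))
        ≡ attends H (onActor r a) (onEvent r e)
full-on-image φ r r-full φr-full a e = trans (φr-full a e) (sym (r-full a e))

ThreeActors : AN → Set
ThreeActors H = Σ (Actor H) λ a → Σ (Actor H) λ b → Σ (Actor H) λ c →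
  a ≢ b × a ≢ c × b ≢ c × (∀ x → x ≡ a ⊎ x ≡ b ⊎ x ≡ c)

TwoAttendees : (H : AN) → Event H → Set
TwoAttendees H e = Σ (Actor H) λ a → Σ (Actor H) λ b →
  a ≢ b × attends H a e ≡ true × attends H b e ≡ true

threeActors-transport : {H K : AN} (f : Actor H → Actor K) (g : Actor K → Actor H) →
  (∀ x → f (g x) ≡ x) → Injective _≡_ _≡_ f → ThreeActors H → ThreeActors K
threeActors-transport f g f∘g f-inj (a , b , c , a≢b , a≢c , b≢c , cover) =
  f a , f b , f c , a≢b ∘ f-inj , a≢c ∘ f-inj , b≢c ∘ f-inj ,
  λ x → Sum.map (back x) (Sum.map (back x) (back x)) (cover (g x))
  where
  back : ∀ x {y} → g x ≡ y → x ≡ f y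
  back x p = trans (sym (f∘g x)) (cong f p)

image-twoAttendees : {H K : AN} (f : Mor H K) → (∀ e → TwoAttendees H e) →
                     ∀ e → TwoAttendees K (onEvent f e)
image-twoAttendees f two e =
  let (a , b , a≢b , a∈e , b∈e) = two e
  in onActor f a , onActor f b , a≢b ∘ actorsDistinct f ,
     preserves f a e a∈e , preserves f b e b∈e

full∈C : {C : MorPred} → Axiom1 C → {H K : AN} → IsTriad H → IsTriad K →
         (f : Mor H K) → Injective _≡_ _≡_ (onEvent f) → Full f → C f
full∈C ax1 H-triad K-triad f fe-inj full =
  ax1 f H-triad K-triad (actorsDistinct f , fe-inj) (full⇒induced f full)

Fin3-cover : ∀ (x : Fin 3) → x ≡ zero ⊎ x ≡ suc zero ⊎ x ≡ suc (suc zero)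
Fin3-cover zero = inj₁ refl
Fin3-cover (suc zero) = inj₂ (inj₁ refl)
Fin3-cover (suc (suc zero)) = inj₂ (inj₂ refl)

W-triad : IsTriad W
W-triad = (zero , suc zero , suc (suc zero) , (λ ()) , (λ ()) , (λ ()) , Fin3-cover) , two
  where
  two : ∀ e → TwoAttendees W e
  two zero = zero , suc zero , (λ ()) , refl , refl
  two (suc zero) = suc zero , suc (suc zero) , (λ ()) , refl , refl

X-triad : IsTriad X
X-triad = (zero , suc zero , suc (suc zero) , (λ ()) , (λ ()) , (λ ()) , Fin3-cover) , two
  where
  two : ∀ e → TwoAttendees X e
  two zero = zero , suc zero , (λ ()) , refl , refl
  two (suc zero) = suc zero , suc (suc zero) , (λ ()) , refl , refl
  two (suc (suc zero)) = suc (suc zero) , zero , (λ ()) , refl , refl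

W-separated : EventsSeparated W
W-separated = from-yes (all? λ e → all? λ e' →
  all? (λ a → attW a e Bool.≟ attW a e') →-dec e ≟ e')

X-separated : EventsSeparated X
X-separated = from-yes (all? λ e → all? λ e' →
  all? (λ a → attX a e Bool.≟ attX a e') →-dec e ≟ e')

actor-injective : {G : AN} {i j k : Actor G} → Injective _≡_ _≡_ (actor {G} {i} {j} {k})
actor-injective {x = sa a _} {y = sa .a _} refl = refl

event-injective : {G : AN} {i j k : Actor G} → Injective _≡_ _≡_ (event {G} {i} {j} {k})
event-injective {x = se e _} {y = se .e _} refl = refl

scheduled : {G : AN} {i j k : Actor G} (e : Event G) (s t : SchedActor G i j k) → s ≢ t →
            attends G (actor s) e ≡ true → attends G (actor t) e ≡ true → SchedEvent G i j k
scheduled e (sa a a∈) (sa b b∈) s≢t a∈e b∈e =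
  se e (a , b , s≢t ∘ actor-injective , a∈ , b∈ , a∈e , b∈e)

adjoinEvents : (G : AN) (E : Set) → Finite E → (Actor G → E → Bool) → AN
adjoinEvents G E E-finite attendsNew = record
  { Actor = Actor G
  ; Event = Event G ⊎ E
  ; attends = λ a → [ attends G a , attendsNew a ]′
  ; actorsFinite = actorsFinite G
  ; eventsFinite = finite-⊎ (eventsFinite G) E-finite }

module WedgeCopy {C : MorPred} {_∼_ : MorRel} (sub : IsSubcategory C)
  (ax1 : Axiom1 C) (ax2 : Axiom2 C _∼_) (ax3 : Axiom3 C _∼_)
  (G : AN) (i j k : Actor G) (i≢j : i ≢ j) (i≢k : i ≢ k) (j≢k : j ≢ k)
  (φ : Mor W (Triad G i j k)) (φ∈C : C φ) where

  image : Actor W → Actor G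
  image a = actor (onActor φ a)

  image-injective : Injective _≡_ _≡_ image
  image-injective = actorsDistinct φ ∘ actor-injective

  _≟G_ : DecidableEquality (Actor G)
  _≟G_ = finite⇒≟ (actorsFinite G)

  imageOfAttendee? : (g : Actor G) (e : Event W) →
                     Dec (Σ (Actor W) λ a → attW a e ≡ true × g ≡ image a)
  imageOfAttendee? g e = any? λ a → (attW a e Bool.≟ true) ×-dec (g ≟G image a)

  attendsCopy : Actor G → Event W → Bool
  attendsCopy g e = does (imageOfAttendee? g e)

  attendsCopy-image : ∀ a e → attendsCopy (image a) e ≡ attW a e
  attendsCopy-image a e with attW a e in a∈e
  ... | true  = dec-true (imageOfAttendee? (image a) e) (a , a∈e , refl)
  ... | false = dec-false (imageOfAttendee? (image a) e) λ (b , b∈e , a≡b) →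
    Bool.not-¬ b∈e (subst (λ c → attW c e ≡ false) (image-injective a≡b) a∈e)

  G⁺ : AN
  G⁺ = adjoinEvents G (Event W) (eventsFinite W) attendsCopy

  T T⁺ : AN
  T = Triad G i j k
  T⁺ = Triad G⁺ i j k

  lift : Actor T → Actor T⁺
  lift (sa a a∈) = sa a a∈

  unlift : Actor T⁺ → Actor T
  unlift (sa a a∈) = sa a a∈

  lift-injective : Injective _≡_ _≡_ lift
  lift-injective = actor-injective ∘ cong actor

  liftEvent : Event T → Event T⁺
  liftEvent (se e two) = se (inj₁ e) two

  incl : Mor T T⁺
  incl = fullMor lift liftEvent lift-injective λ _ _ → refl

  copyEvent : Event W → Event T⁺
  copyEvent e =
    let (a , b , a≢b , a∈e , b∈e) = proj₂ W-triad e
    in scheduled (inj₂ e) (lift (onActor φ a)) (lift (onActor φ b))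
                 (a≢b ∘ actorsDistinct φ ∘ lift-injective)
                 (trans (attendsCopy-image a e) a∈e) (trans (attendsCopy-image b e) b∈e)

  copy : Mor W T⁺
  copy = fullMor (lift ∘ onActor φ) copyEvent (actorsDistinct φ ∘ lift-injective)
                 attendsCopy-image

  T-triad : IsTriad T
  T-triad = IsSubcategory.cod-triad sub φ∈C

  T⁺-triad : IsTriad T⁺
  T⁺-triad =
    threeActors-transport {T} {T⁺} lift unlift (λ _ → refl) lift-injective (proj₁ T-triad) , two
    where
    two : ∀ e → TwoAttendees T⁺ e
    two (se (inj₁ e) e∈T) = image-twoAttendees incl (proj₂ T-triad) (se e e∈T)
    two (se (inj₂ e) _)   = image-twoAttendees copy (proj₂ W-triad) e

  incl∘φ∈C : C (incl ∘M φ)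
  incl∘φ∈C = IsSubcategory.comp sub φ∈C
    (full∈C ax1 T-triad T⁺-triad incl (event-injective ∘ inj₁-injective ∘ cong event)
            λ _ _ → refl)

  copy∈C : C copy
  copy∈C = full∈C ax1 W-triad T⁺-triad copy
    (full⇒onEvent-injective copy W-separated attendsCopy-image) attendsCopy-image

  incl∘φ≃copy : (incl ∘M φ) ≃ copy
  incl∘φ≃copy = ax2 incl∘φ∈C copy∈C
    (ax3 G⁺ i j k i≢j i≢k j≢k
         (onActor copy zero) (onActor copy (suc zero)) (onActor copy (suc (suc zero)))
         ((λ ()) ∘ actorsDistinct copy) ((λ ()) ∘ actorsDistinct copy)
         ((λ ()) ∘ actorsDistinct copy)
         (incl ∘M φ) copy incl∘φ∈C copy∈C (refl , refl , refl) (refl , refl , refl))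

  wedge-full : Full φ
  wedge-full a e = begin
    attends G (image a) (event (onEvent φ e)) ≡⟨ proj₂ incl∘φ≃copy e (onActor copy a) ⟩
    attendsCopy (image a) e                    ≡⟨ attendsCopy-image a e ⟩
    attW a e                                   ∎
    where open ≡-Reasoning

-- The rotation vᵢ ↦ vᵢ₊₂ of the hexagon X, on actors as well as on events.
rot : Fin 3 → Fin 3
rot zero             = suc zero
rot (suc zero)       = suc (suc zero)
rot (suc (suc zero)) = zero

rot³≡id : ∀ a → rot (rot (rot a)) ≡ a
rot³≡id zero             = refl
rot³≡id (suc zero)       = refl
rot³≡id (suc (suc zero)) = refl

rot-injective : Injective _≡_ _≡_ rot
rot-injective {a} {b} p = trans (sym (rot³≡id a)) (trans (cong (rot ∘ rot) p) (rot³≡id b))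

ι-full : ∀ a e → attX a (inject₁ e) ≡ attW a e
ι-full = from-yes (all? λ a → all? λ e → attX a (inject₁ e) Bool.≟ attW a e)

ρι-full : ∀ a e → attX (rot a) (rot (inject₁ e)) ≡ attW a e
ρι-full = from-yes (all? λ a → all? λ e → attX (rot a) (rot (inject₁ e)) Bool.≟ attW a e)

ι ρι : Mor W X
ι  = fullMor (λ a → a) inject₁ (λ p → p) ι-full
ρι = fullMor rot (rot ∘ inject₁) rot-injective ρι-full

alcove-full : {K : AN} (φ : Mor X K) → Full (φ ∘M ι) → Full (φ ∘M ρι) → Full φ
alcove-full φ φι-full φρι-full a zero       = full-on-image φ ι ι-full φι-full a zero
alcove-full φ φι-full φρι-full a (suc zero) = full-on-image φ ι ι-full φι-full a (suc zero)
alcove-full {K} φ φι-full φρι-full a (suc (suc zero)) =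
  subst (λ b → attends K (onActor φ b) (onEvent φ (suc (suc zero))) ≡ attX b (suc (suc zero)))
        (rot³≡id a) (full-on-image φ ρι ρι-full φρι-full (rot (rot a)) (suc zero))

EveryMorphismFull : MorPred → AN → Set₁
EveryMorphismFull C H = ∀ (G : AN) (i j k : Actor G) → i ≢ j → i ≢ k → j ≢ k →
  ∀ (φ : Mor H (Triad G i j k)) → C φ → Full φ

full⇒everyClassInjInduced : {C : MorPred} {_∼_ : MorRel} → IsCongruence C _∼_ →
  {H : AN} → EventsSeparated H → EveryMorphismFull C H → EveryClassInjInduced C _∼_ H
full⇒everyClassInjInduced congruence separated full G i j k i≢j i≢k j≢k φ φ∈C =
  φ , φ∈C , IsCongruence.refl∼ congruence φ∈C ,
  (actorsDistinct φ , full⇒onEvent-injective φ separated φ-full) , full⇒induced φ φ-full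
  where
  φ-full : Full φ
  φ-full = full G i j k i≢j i≢k j≢k φ φ∈C

lemma4 : (C : MorPred) (_∼_ : MorRel) →
    IsSubcategory C → IsCongruence C _∼_ →
    Axiom1 C → Axiom2 C _∼_ → Axiom3 C _∼_ →
    EveryClassInjInduced C _∼_ W × EveryClassInjInduced C _∼_ X
lemma4 C _∼_ sub congruence ax1 ax2 ax3 =
  full⇒everyClassInjInduced congruence W-separated wedges-full ,
  full⇒everyClassInjInduced congruence X-separated alcoves-full
  where
  wedges-full : EveryMorphismFull C W
  wedges-full G i j k i≢j i≢k j≢k φ φ∈C =
    WedgeCopy.wedge-full sub ax1 ax2 ax3 G i j k i≢j i≢k j≢k φ φ∈C

  in-C : (r : Mor W X) → Full r → C r
  in-C r r-full =
    full∈C ax1 W-triad X-triad r (full⇒onEvent-injective r W-separated r-full) r-full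

  alcoves-full : EveryMorphismFull C X
  alcoves-full G i j k i≢j i≢k j≢k φ φ∈C = alcove-full φ
    (wedges-full G i j k i≢j i≢k j≢k (φ ∘M ι)  (IsSubcategory.comp sub (in-C ι ι-full) φ∈C))
    (wedges-full G i j k i≢j i≢k j≢k (φ ∘M ρι) (IsSubcategory.comp sub (in-C ρι ρι-full) φ∈C))
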